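{- Let $\Gamma=A_1,\ldots,A_m$ and $\Delta=B_1,\ldots,B_n$ be finite lists of formulas built from atoms with the connectives $\neg,\wedge,\vee$. If the sequent $\Gamma\vdash\Delta$ is provable in $\mathsf{LK}$, then it is provable in $\mathsf{LKQ}$, i.e. there exists a command $c$ of the calculus $\mathsf{L}_{\mathrm{foc}}$ such that $c:(x_1:A_1,\ldots,x_m:A_m\vdash\alpha_1:B_1,\ldots,\alpha_n:B_n)$ is derivable in $\mathsf{LKQ}$ (where in $\mathsf{LKQ}$ the connectives $\wedge,\vee,\neg$ are read as $\otimes,\oplus,\neg$).
   Context: $\mathsf{LK}$ here is the classical sequent calculus with connectives $\neg,\wedge,\vee$ and the rules: axiom $\Gamma,A\vdash A,\Delta$; additive cut (from $\Gamma\vdash A,\Delta$ and $\Gamma,A\vdash\Delta$ infer $\Gamma\vdash\Delta$); $\neg$-right (from $\Gamma,A\vdash\Delta$ infer $\Gamma\vdash\neg A,\Delta$); $\neg$-left (from $\Gamma\vdash A,\Delta$ infer $\Gamma,\neg A\vdash\Delta$); $\wedge$-right additive (from $\Gamma\vdash A_1,\Delta$ and $\Gamma\vdash A_2,\Delta$ infer $\Gamma\vdash A_1\wedge A_2,\Delta$); $\wedge$-left (from $\Gamma,A_1,A_2\vdash\Delta$ infer $\Gamma,A_1\wedge A_2\vdash\Delta$); $\vee$-right (from $\Gamma\vdash A_i,\Delta$ infer $\Gamma\vdash A_1\vee A_2,\Delta$, $i=1,2$); $\vee$-left (from $\Gamma,A_1\vdash\Delta$ and $\Gamma,A_2\vdash\Delta$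 infer $\Gamma,A_1\vee A_2\vdash\Delta$); weakening is implicit. $\mathsf{LKQ}$ / $\mathsf{L}_{\mathrm{foc}}$. Positive formulas: $P::=X\mid P\otimes P\mid P\oplus P\mid\neg P$ ($X$ atoms). Terms, with ordinary variables $x$ and continuation variables $\alpha$: commands $c::=\langle v\,|\,e\rangle\mid c[\sigma]$; expressions $v::=\widehat V\mid\mu\alpha.c\mid v[\sigma]$; values $V::=x\mid(V,V)\mid\mathrm{inl}(V)\mid\mathrm{inr}(V)\mid e^\bullet\mid V[\sigma]$; contexts $e::=\alpha\mid\tilde\mu x.c\mid\tilde\mu\alpha^\bullet.c\mid\tilde\mu(x_1,x_2).c\mid\tilde\mu[\mathrm{inl}(x_1).c_1|\mathrm{inr}(x_2).c_2]\mid e[\sigma]$, where $\sigma$ is a list of explicit substitutions $[x_i\leftarrow V_i],[\alpha_j\leftarrow e_j]$. $\widehat V$ is the coercion of a value to an expression. Judgements ($\Gamma$ a set of declarations $x:P$, $\Delta$ a set of declarations $\alpha:P$): $c:(\Gamma\vdash\Delta)$, $\Gamma\vdash v:P\mid\Delta$, $\Gamma\vdash V:P;\Delta$, $\Gamma\mid e:P\vdash\Delta$. Rules: $\Gamma,x:P\vdash x:P;\Delta$; $\Gamma\mid\alpha:P\vdash\alpha:P,\Delta$; from $\Gamma\vdash v:P\mid\Delta$ and $\Gamma\mid e:P\vdash\Delta$ infer $\langle v|e\rangle:(\Gamma\vdash\Delta)$; from $c:(\Gamma,x:P\vdash\Delta)$ infer $\Gamma\mid\tilde\mu x.c:P\vdash\Delta$;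 from $c:(\Gamma\vdash\alpha:P,\Delta)$ infer $\Gamma\vdash\mu\alpha.c:P\mid\Delta$; from $\Gamma\vdash V:P;\Delta$ infer $\Gamma\vdash\widehat V:P\mid\Delta$; from $\Gamma\mid e:P\vdash\Delta$ infer $\Gamma\vdash e^\bullet:\neg P;\Delta$; from $\Gamma\vdash V_i:P_i;\Delta$ ($i=1,2$) infer $\Gamma\vdash(V_1,V_2):P_1\otimes P_2;\Delta$; from $\Gamma\vdash V_1:P_1;\Delta$ infer $\Gamma\vdash\mathrm{inl}(V_1):P_1\oplus P_2;\Delta$ (similarly $\mathrm{inr}$); from $c:(\Gamma\vdash\alpha:P,\Delta)$ infer $\Gamma\mid\tilde\mu\alpha^\bullet.c:\neg P\vdash\Delta$; from $c:(\Gamma,x_1:P_1,x_2:P_2\vdash\Delta)$ infer $\Gamma\mid\tilde\mu(x_1,x_2).c:P_1\otimes P_2\vdash\Delta$; from $c_i:(\Gamma,x_i:P_i\vdash\Delta)$ ($i=1,2$) infer $\Gamma\mid\tilde\mu[\mathrm{inl}(x_1).c_1|\mathrm{inr}(x_2).c_2]:P_1\oplus P_2\vdash\Delta$; from $c:(\Gamma,\ldots,x_i:P_i,\ldots\vdash\Delta,\ldots,\alpha_j:Q_j,\ldots)$, $\Gamma\vdash V_i:P_i;\Delta$ and $\Gamma\mid e_j:Q_j\vdash\Delta$ infer $c[\ldots,x_i\leftarrow V_i,\ldots,\alpha_j\leftarrow e_j,\ldots]:(\Gamma\vdash\Delta)$ (likewise for $v[\sigma],V[\sigma],e[\sigma]$).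 Weakening is implicit: a judgement derivable with $\Gamma,\Delta$ remains derivable with larger $\Gamma,\Delta$. -}

module Defs where

open import Data.Nat using (ℕ; zero; suc)
open import Data.List using (List; []; _∷_)
open import Data.List.Membership.Propositional using (_∈_)
open import Data.Product using (_×_; _,_)
open import Relation.Binary.PropositionalEquality using (_≢_)

data Fml : Set where
  atom : ℕ → Fml
  ¬ᶠ_  : Fml → Fml
  _∧ᶠ_ : Fml → Fml → Fml
  _∨ᶠ_ : Fml → Fml → Fml

-- Sequents Γ ⊢ Δ with Γ, Δ lists read as sets; weakening is
-- implicit (axiom by membership), and the principal formula of the
-- conclusion is required to be a member of the conclusion context
-- (the premise context keeps it, which is harmless since contexts are
-- sets and weakening is implicit).

data LK : List Fml → List Fml → Set where
  ax   : ∀ {Γ Δ A} → A ∈ Γ → A ∈ Δ → LK Γ Δ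
  cut  : ∀ {Γ Δ} A → LK Γ (A ∷ Δ) → LK (A ∷ Γ) Δ → LK Γ Δ
  ¬R   : ∀ {Γ Δ A} → (¬ᶠ A) ∈ Δ → LK (A ∷ Γ) Δ → LK Γ Δ
  ¬L   : ∀ {Γ Δ A} → (¬ᶠ A) ∈ Γ → LK Γ (A ∷ Δ) → LK Γ Δ
  ∧R   : ∀ {Γ Δ A₁ A₂} → (A₁ ∧ᶠ A₂) ∈ Δ →
         LK Γ (A₁ ∷ Δ) → LK Γ (A₂ ∷ Δ) → LK Γ Δ
  ∧L   : ∀ {Γ Δ A₁ A₂} → (A₁ ∧ᶠ A₂) ∈ Γ →
         LK (A₁ ∷ A₂ ∷ Γ) Δ → LK Γ Δ
  ∨R₁  : ∀ {Γ Δ A₁ A₂} → (A₁ ∨ᶠ A₂) ∈ Δ → LK Γ (A₁ ∷ Δ) → LK Γ Δ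
  ∨R₂  : ∀ {Γ Δ A₁ A₂} → (A₁ ∨ᶠ A₂) ∈ Δ → LK Γ (A₂ ∷ Δ) → LK Γ Δ
  ∨L   : ∀ {Γ Δ A₁ A₂} → (A₁ ∨ᶠ A₂) ∈ Γ →
         LK (A₁ ∷ Γ) Δ → LK (A₂ ∷ Γ) Δ → LK Γ Δ

data Pos : Set where
  X   : ℕ → Pos
  _⊗_ : Pos → Pos → Pos
  _⊕_ : Pos → Pos → Pos
  ¬ᵖ_ : Pos → Pos

⟦_⟧ : Fml → Pos
⟦ atom n ⟧  = X n
⟦ ¬ᶠ A ⟧    = ¬ᵖ ⟦ A ⟧
⟦ A ∧ᶠ B ⟧  = ⟦ A ⟧ ⊗ ⟦ B ⟧
⟦ A ∨ᶠ B ⟧  = ⟦ A ⟧ ⊕ ⟦ B ⟧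

-- Terms of L_foc.  Ordinary variables x and continuation variables α
-- are both named by natural numbers (separate namespaces).

Var : Set
Var = ℕ

CVar : Set
CVar = ℕ

mutual
  data Cmd : Set where
    ⟨_∣_⟩  : Expr → Ctxt → Cmd
    _[_]ᶜ  : Cmd → List SubstEntry → Cmd

  data Expr : Set where
    ^_     : Val → Expr
    μ      : CVar → Cmd → Expr
    _[_]ᵉ  : Expr → List SubstEntry → Expr

  data Val : Set where
    var    : Var → Val
    pair   : Val → Val → Val
    inl    : Val → Val
    inr    : Val → Val
    _•     : Ctxt → Val
    _[_]ᵛ  : Val → List SubstEntry → Val

  data Ctxt : Set where
    cvar   : CVar → Ctxt
    μ̃      : Var → Cmd → Ctxt
    μ̃•     : CVar → Cmd → Ctxt
    μ̃pair  : Var → Var → Cmd → Ctxt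
    μ̃case  : Var → Cmd → Var → Cmd → Ctxt
    _[_]ᵏ  : Ctxt → List SubstEntry → Ctxt

  data SubstEntry : Set where
    _←ᵛ_ : Var → Val → SubstEntry
    _←ᵏ_ : CVar → Ctxt → SubstEntry

-- Typing contexts: lists of declarations, extension by consing; a
-- declaration is looked up at its most recent occurrence (so Γ , x:P
-- shadows any earlier declaration of x).

Env : Set
Env = List (ℕ × Pos)

data _∋_∶_ : Env → ℕ → Pos → Set where
  here  : ∀ {Γ x P} → ((x , P) ∷ Γ) ∋ x ∶ P
  there : ∀ {Γ x y P Q} → x ≢ y → Γ ∋ x ∶ P → ((y , Q) ∷ Γ) ∋ x ∶ P

-- CmdTy c Γ Δ        :  c : (Γ ⊢ Δ)
--   ExprTy Γ v P Δ     :  Γ ⊢ v : P | Δ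
--   ValTy Γ V P Δ      :  Γ ⊢ V : P ; Δ
--   CtxtTy Γ e P Δ     :  Γ | e : P ⊢ Δ
--   SubstTy Γ Δ σ Γ' Δ' : σ is well typed in Γ, Δ and extends them to Γ', Δ'

mutual
  data CmdTy : Cmd → Env → Env → Set where
    cutᵗ : ∀ {Γ Δ v e P} → ExprTy Γ v P Δ → CtxtTy Γ e P Δ →
           CmdTy ⟨ v ∣ e ⟩ Γ Δ
    substᶜ : ∀ {Γ Δ Γ' Δ' c σ} → SubstTy Γ Δ σ Γ' Δ' →
             CmdTy c Γ' Δ' → CmdTy (c [ σ ]ᶜ) Γ Δ

  data ExprTy : Env → Expr → Pos → Env → Set where
    valᵗ : ∀ {Γ Δ V P} → ValTy Γ V P Δ → ExprTy Γ (^ V) P Δ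
    μᵗ   : ∀ {Γ Δ α c P} → CmdTy c Γ ((α , P) ∷ Δ) → ExprTy Γ (μ α c) P Δ
    substᵉ : ∀ {Γ Δ Γ' Δ' v σ P} → SubstTy Γ Δ σ Γ' Δ' →
             ExprTy Γ' v P Δ' → ExprTy Γ (v [ σ ]ᵉ) P Δ

  data ValTy : Env → Val → Pos → Env → Set where
    varᵗ  : ∀ {Γ Δ x P} → Γ ∋ x ∶ P → ValTy Γ (var x) P Δ
    pairᵗ : ∀ {Γ Δ V₁ V₂ P₁ P₂} → ValTy Γ V₁ P₁ Δ → ValTy Γ V₂ P₂ Δ →
            ValTy Γ (pair V₁ V₂) (P₁ ⊗ P₂) Δ
    inlᵗ  : ∀ {Γ Δ V P₁ P₂} → ValTy Γ V P₁ Δ → ValTy Γ (inl V) (P₁ ⊕ P₂) Δ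
    inrᵗ  : ∀ {Γ Δ V P₁ P₂} → ValTy Γ V P₂ Δ → ValTy Γ (inr V) (P₁ ⊕ P₂) Δ
    •ᵗ    : ∀ {Γ Δ e P} → CtxtTy Γ e P Δ → ValTy Γ (e •) (¬ᵖ P) Δ
    substᵛ : ∀ {Γ Δ Γ' Δ' V σ P} → SubstTy Γ Δ σ Γ' Δ' →
             ValTy Γ' V P Δ' → ValTy Γ (V [ σ ]ᵛ) P Δ

  data CtxtTy : Env → Ctxt → Pos → Env → Set where
    cvarᵗ : ∀ {Γ Δ α P} → Δ ∋ α ∶ P → CtxtTy Γ (cvar α) P Δ
    μ̃ᵗ    : ∀ {Γ Δ x c P} → CmdTy c ((x , P) ∷ Γ) Δ → CtxtTy Γ (μ̃ x c) P Δ
    μ̃•ᵗ   : ∀ {Γ Δ α c P} → CmdTy c Γ ((α , P) ∷ Δ) →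
            CtxtTy Γ (μ̃• α c) (¬ᵖ P) Δ
    μ̃pairᵗ : ∀ {Γ Δ x₁ x₂ c P₁ P₂} →
             CmdTy c ((x₂ , P₂) ∷ (x₁ , P₁) ∷ Γ) Δ →
             CtxtTy Γ (μ̃pair x₁ x₂ c) (P₁ ⊗ P₂) Δ
    μ̃caseᵗ : ∀ {Γ Δ x₁ x₂ c₁ c₂ P₁ P₂} →
             CmdTy c₁ ((x₁ , P₁) ∷ Γ) Δ → CmdTy c₂ ((x₂ , P₂) ∷ Γ) Δ →
             CtxtTy Γ (μ̃case x₁ c₁ x₂ c₂) (P₁ ⊕ P₂) Δ
    substᵏ : ∀ {Γ Δ Γ' Δ' e σ P} → SubstTy Γ Δ σ Γ' Δ' →
             CtxtTy Γ' e P Δ' → CtxtTy Γ (e [ σ ]ᵏ) P Δ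

  data SubstTy : Env → Env → List SubstEntry → Env → Env → Set where
    []ᵗ  : ∀ {Γ Δ} → SubstTy Γ Δ [] Γ Δ
    ←ᵛᵗ  : ∀ {Γ Δ Γ' Δ' x V P σ} → ValTy Γ V P Δ →
           SubstTy Γ Δ σ Γ' Δ' →
           SubstTy Γ Δ ((x ←ᵛ V) ∷ σ) ((x , P) ∷ Γ') Δ'
    ←ᵏᵗ  : ∀ {Γ Δ Γ' Δ' α e Q σ} → CtxtTy Γ e Q Δ →
           SubstTy Γ Δ σ Γ' Δ' →
           SubstTy Γ Δ ((α ←ᵏ e) ∷ σ) Γ' ((α , Q) ∷ Δ')

nameFrom : ℕ → List Fml → Env
nameFrom k []       = []
nameFrom k (A ∷ As) = (k , ⟦ A ⟧) ∷ nameFrom (suc k) As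

names : List Fml → Env
names = nameFrom zero

-- The translation is by induction on the LK derivation, but it cannot be
-- stated for the fixed environments `names Γ`, `names Δ`: each rule binds
-- new variables (μα, μ̃x, μ̃(x₁,x₂), …) and so enlarges the typing
-- environments.  We therefore translate relative to an arbitrary *naming*
-- (`Naming Γ E n`): every formula of Γ is declared in E under some name
-- below n, so n is always a fresh name that cannot shadow a used one.  Implicit weakening of LK is absorbed by the generality of
-- namings: the environments may declare more than Γ and Δ.
module Submission where

open import Defs
open import Data.List using (List; _∷_; length)
open import Data.List.Membership.Propositional using (_∈_)
open import Data.List.Relation.Unary.Any using (here; there)
open import Data.List.Relation.Binary.Subset.Propositional using (_⊆_)
open import Data.List.Relation.Binary.Permutation.Propositional using (↭-refl; swap)
open import Data.List.Relation.Binary.Permutation.Propositional.Properties using (∈-resp-↭)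
open import Data.Nat using (ℕ; suc; _+_; _<_; _≤_; s≤s; z≤n)
open import Data.Nat.Properties using (≤-refl; <⇒≤; <⇒≢; m<m+n; m≤n⇒m≤1+n; n<1+n; +-suc)
open import Data.Product using (∃; _×_; _,_)
open import Relation.Binary.PropositionalEquality using (refl; sym; subst)

lookup-fresh : ∀ {E x n P Q} → x < n → E ∋ x ∶ P → ((n , Q) ∷ E) ∋ x ∶ P
lookup-fresh x<n l = there (<⇒≢ x<n) l

Naming : List Fml → Env → ℕ → Set
Naming Γ E n = ∀ {A} → A ∈ Γ → ∃ λ x → x < n × E ∋ x ∶ ⟦ A ⟧

Naming-fresh : ∀ {Γ E n P} → Naming Γ E n → Naming Γ ((n , P) ∷ E) (suc n)
Naming-fresh r A∈Γ with r A∈Γ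
... | x , x<n , l = x , m≤n⇒m≤1+n x<n , lookup-fresh x<n l

Naming-bind : ∀ {Γ E n} A → Naming Γ E n → Naming (A ∷ Γ) ((n , ⟦ A ⟧) ∷ E) (suc n)
Naming-bind A r (here refl) = _ , n<1+n _ , here
Naming-bind A r (there A∈Γ) = Naming-fresh r A∈Γ

Naming-⊆ : ∀ {Γ Γ′ E n} → Γ′ ⊆ Γ → Naming Γ E n → Naming Γ′ E n
Naming-⊆ Γ′⊆Γ r A∈Γ′ = r (Γ′⊆Γ A∈Γ′)

nameFrom-≥ : ∀ {k} Γ {x P} → nameFrom k Γ ∋ x ∶ P → k ≤ x
nameFrom-≥ (B ∷ Γ) here       = ≤-refl
nameFrom-≥ (B ∷ Γ) (there _ l) = <⇒≤ (nameFrom-≥ Γ l)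

-- `nameFrom k Γ` is a naming of Γ by the variables k, …, k + length Γ - 1;
-- a later declaration never shadows an earlier one since it is larger.
nameFrom-Naming : ∀ k Γ → Naming Γ (nameFrom k Γ) (k + length Γ)
nameFrom-Naming k (B ∷ Γ) (here refl) = k , m<m+n k (s≤s z≤n) , here
nameFrom-Naming k (B ∷ Γ) (there A∈Γ) with nameFrom-Naming (suc k) Γ A∈Γ
... | x , x<bound , l =
  x , subst (x <_) (sym (+-suc k (length Γ))) x<bound ,
  there (λ x≡k → <⇒≢ (nameFrom-≥ Γ l) (sym x≡k)) l

names-Naming : ∀ Γ → Naming Γ (names Γ) (length Γ)
names-Naming = nameFrom-Naming 0

-- Writing
-- x, α for the names of the principal formula and ⟨d⟩ for translated
-- premises, the commands are:
--   ax      ⟨ x̂ ∣ α ⟩                  cut     ⟨ μm.⟨d₁⟩ ∣ μ̃n.⟨d₂⟩ ⟩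
--   ¬R      ⟨ (μ̃n.⟨d⟩)• ∣ α ⟩           ¬L      ⟨ x̂ ∣ μ̃m•.⟨d⟩ ⟩
--   ∧R      ⟨ μm.⟨d₁⟩ ∣ μ̃n.⟨ μm.⟨d₂⟩ ∣ μ̃(n+1).⟨ (n, n+1)^ ∣ α ⟩ ⟩ ⟩
--   ∧L      ⟨ x̂ ∣ μ̃(n, n+1).⟨d⟩ ⟩
--   ∨Rᵢ     ⟨ μm.⟨d⟩ ∣ μ̃n.⟨ inᵢ(n)^ ∣ α ⟩ ⟩
--   ∨L      ⟨ x̂ ∣ μ̃[inl(n).⟨d₁⟩ | inr(n).⟨d₂⟩] ⟩
translate : ∀ {Γ Δ} → LK Γ Δ → ∀ {E F n m} → Naming Γ E n → Naming Δ F m →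
            ∃ λ (c : Cmd) → CmdTy c E F
translate (ax A∈Γ A∈Δ) rΓ rΔ with rΓ A∈Γ | rΔ A∈Δ
... | _ , _ , x | _ , _ , α = _ , cutᵗ (valᵗ (varᵗ x)) (cvarᵗ α)
translate (cut A d₁ d₂) rΓ rΔ
  with translate d₁ rΓ (Naming-bind A rΔ) | translate d₂ (Naming-bind A rΓ) rΔ
... | _ , c₁ | _ , c₂ = _ , cutᵗ (μᵗ c₁) (μ̃ᵗ c₂)
translate (¬R {A = A} ¬A∈Δ d) rΓ rΔ
  with rΔ ¬A∈Δ | translate d (Naming-bind A rΓ) rΔ
... | _ , _ , α | _ , c = _ , cutᵗ (valᵗ (•ᵗ (μ̃ᵗ c))) (cvarᵗ α)
translate (¬L {A = A} ¬A∈Γ d) rΓ rΔ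
  with rΓ ¬A∈Γ | translate d rΓ (Naming-bind A rΔ)
... | _ , _ , x | _ , c = _ , cutᵗ (valᵗ (varᵗ x)) (μ̃•ᵗ c)
translate (∧R {A₁ = A₁} {A₂} A∈Δ d₁ d₂) rΓ rΔ
  with rΔ A∈Δ | translate d₁ rΓ (Naming-bind A₁ rΔ)
     | translate d₂ (Naming-fresh rΓ) (Naming-bind A₂ rΔ)
... | _ , _ , α | _ , c₁ | _ , c₂ =
  _ , cutᵗ (μᵗ c₁) (μ̃ᵗ (cutᵗ (μᵗ c₂) (μ̃ᵗ (cutᵗ
        (valᵗ (pairᵗ (varᵗ (lookup-fresh (n<1+n _) here)) (varᵗ here)))
        (cvarᵗ α)))))
translate (∧L {A₁ = A₁} {A₂} A∈Γ d) rΓ rΔ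
  with rΓ A∈Γ
     | translate d (Naming-⊆ (∈-resp-↭ (swap A₁ A₂ ↭-refl))
                             (Naming-bind A₂ (Naming-bind A₁ rΓ))) rΔ
... | _ , _ , x | _ , c = _ , cutᵗ (valᵗ (varᵗ x)) (μ̃pairᵗ c)
translate (∨R₁ {A₁ = A₁} A∈Δ d) {n = n} rΓ rΔ
  with rΔ A∈Δ | translate d rΓ (Naming-bind A₁ rΔ)
... | _ , _ , α | _ , c =
  _ , cutᵗ (μᵗ c) (μ̃ᵗ {x = n} (cutᵗ (valᵗ (inlᵗ (varᵗ here))) (cvarᵗ α)))
translate (∨R₂ {A₂ = A₂} A∈Δ d) {n = n} rΓ rΔ
  with rΔ A∈Δ | translate d rΓ (Naming-bind A₂ rΔ)
... | _ , _ , α | _ , c =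
  _ , cutᵗ (μᵗ c) (μ̃ᵗ {x = n} (cutᵗ (valᵗ (inrᵗ (varᵗ here))) (cvarᵗ α)))
translate (∨L {A₁ = A₁} {A₂} A∈Γ d₁ d₂) rΓ rΔ
  with rΓ A∈Γ | translate d₁ (Naming-bind A₁ rΓ) rΔ
     | translate d₂ (Naming-bind A₂ rΓ) rΔ
... | _ , _ , x | _ , c₁ | _ , c₂ = _ , cutᵗ (valᵗ (varᵗ x)) (μ̃caseᵗ c₁ c₂)

proposition1 : (Γ Δ : List Fml) → LK Γ Δ →
    ∃ λ (c : Cmd) → CmdTy c (names Γ) (names Δ)
proposition1 Γ Δ d = translate d (names-Naming Γ) (names-Naming Δ)
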